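{- Let $p$ be a prime and $q\in\mathbb{C}_p$ with $|1-q|_p<1$. For every $n\in\mathbb{N}$ with $n>1$, $$\beta_{n,q}(2)=\frac{1}{q^2}\beta_{n,q}+n+1-\frac{1}{q}.$$
   Context: For $y\in\mathbb{Z}_p$, $[y]_q=\frac{1-q^y}{1-q}$. The Carlitz $q$-Bernoulli numbers $\beta_{k,q}$ are defined by $\beta_{0,q}=1$ and $q(q\beta+1)^k-\beta_{k,q}=1$ if $k=1$, $=0$ if $k>1$, with the umbral convention that after expanding $(q\beta+1)^k$ by the binomial theorem each $\beta^i$ is replaced by $\beta_{i,q}$. The Carlitz $q$-Bernoulli polynomials are $\beta_{k,q}(x)=\sum_{i=0}^k\binom{k}{i}\beta_{i,q}q^{ix}[x]_q^{k-i}$. -}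

module Defs where

open import Level using (Level; _⊔_) renaming (suc to lsuc)
open import Data.Nat using (ℕ; zero; suc; _∸_; _≤ᵇ_; _≡ᵇ_) renaming (_*_ to _*ℕ_)
open import Data.Nat.Combinatorics using (_C_)
open import Data.Bool using (if_then_else_)
open import Relation.Nullary using (¬_)
open import Algebra.Bundles using (CommutativeRing)
import Algebra.Properties.Group as GroupProps

record Field (c ℓ : Level) : Set (lsuc (c ⊔ ℓ)) where
  field
    commutativeRing : CommutativeRing c ℓ
  open CommutativeRing commutativeRing public
  field
    0≉1   : ¬ (0# ≈ 1#)
    inv   : (x : Carrier) → ¬ (x ≈ 0#) → Carrier
    inv-r : (x : Carrier) (nz : ¬ (x ≈ 0#)) → x * inv x nz ≈ 1#

module _ {c ℓ : Level} (K : Field c ℓ) where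
  open Field K

  fromℕ : ℕ → Carrier
  fromℕ zero    = 0#
  fromℕ (suc n) = 1# + fromℕ n

  pow : Carrier → ℕ → Carrier
  pow x zero    = 1#
  pow x (suc n) = x * pow x n

  sumTo : ℕ → (ℕ → Carrier) → Carrier
  sumTo zero    f = 0#
  sumTo (suc n) f = sumTo n f + f n

-- Carlitz q-Bernoulli numbers and polynomials over a field K, for a
-- parameter q with q ≠ 0 and q not a root of unity (so that all the
-- denominators 1 - q and q^(k+1) - 1 occurring below are nonzero).
module Carlitz {c ℓ : Level} (K : Field c ℓ) (q : Field.Carrier K)
  (q≉0 : ¬ (Field._≈_ K q (Field.0# K)))
  (notRoot : (m : ℕ) → ¬ (Field._≈_ K (pow K q (suc m)) (Field.1# K))) where

  open Field K
  open GroupProps +-group using (x∙y⁻¹≈ε⇒x≈y)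

  denom≉0 : (m : ℕ) → ¬ (pow K q (suc m) - 1# ≈ 0#)
  denom≉0 m eq = notRoot m (x∙y⁻¹≈ε⇒x≈y _ _ eq)

  1-q≉0 : ¬ (1# - q ≈ 0#)
  1-q≉0 eq = notRoot 0 (trans (*-identityʳ q) (sym (x∙y⁻¹≈ε⇒x≈y _ _ eq)))

  q⁻¹ : Carrier
  q⁻¹ = inv q q≉0

  [_]q : ℕ → Carrier
  [ y ]q = (1# - pow K q y) * inv (1# - q) 1-q≉0

  δ₁ : ℕ → Carrier
  δ₁ k = if k ≡ᵇ 1 then 1# else 0#

  -- The defining relation q(qβ+1)^k - β_k = δ_{k,1} (k ≥ 1), expanded by the
  -- binomial theorem, solved for β_k:
  --   (q^(k+1) - 1) β_k = δ_{k,1} - q Σ_{i<k} C(k,i) q^i β_i .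
  next : (k : ℕ) → (ℕ → Carrier) → Carrier
  next k b = inv (pow K q (suc k) - 1#) (denom≉0 k)
             * (δ₁ k - q * sumTo K k (λ i → fromℕ K (k C i) * pow K q i * b i))

  -- βupto n i = β_{i,q} for i ≤ n
  βupto : ℕ → ℕ → Carrier
  βupto zero    i = 1#
  βupto (suc n) i = if i ≤ᵇ n then βupto n i else next (suc n) (βupto n)

  β : ℕ → Carrier
  β k = βupto k k

  βpoly : ℕ → ℕ → Carrier
  βpoly k x = sumTo K (suc k)
    (λ i → fromℕ K (k C i) * β i * pow K q (i *ℕ x) * pow K [ x ]q (k ∸ i))

{-# OPTIONS --safe #-}
-- β_{n,q}(x) is the umbral power (q^x β + [x]_q)^n. Since [x+1]_q = q [x]_q + 1, expanding
-- ((q^x β + q [x]_q) + 1)^n gives the translation formula β_n(x+1) = Σ_j C(n,j) q^j β_j(x).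
-- The defining relation reads q β_j(1) = β_j + δ_{j,1} for j ≥ 1, and β_j(0) = β_j. At x = 1
-- the translation formula therefore gives
--   β_n(2) = q⁻¹ Σ_j C(n,j) q^j β_j(0) + n + (1 - q⁻¹) = q⁻¹ β_n(1) + n + 1 - q⁻¹,
-- and for n > 1 the relation once more gives β_n(1) = q⁻¹ β_n.
module Submission where

open import Defs
open import Level using (Level)
open import Function using (_∘_)
open import Algebra.Bundles using (CommutativeRing)
open import Algebra.Solver.Ring.AlmostCommutativeRing
  using (fromCommutativeRing; _-Raw-AlmostCommutative⟶_)
open import Data.Bool using (true; false; if_then_else_)
open import Data.Empty using (⊥-elim)
open import Data.Maybe using (Maybe; just; nothing)
open import Data.Nat as ℕ using (ℕ; zero; suc; _∸_; _<_; _≤_; _≤ᵇ_; _≡ᵇ_; z≤n; s≤s)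
  renaming (_+_ to _+ℕ_)
import Data.Nat.Properties as ℕ
open import Data.Nat.Combinatorics using (_C_; nCn≡1; nC1≡n; nCk+nC[k+1]≡[n+1]C[k+1])
open import Data.Nat.Combinatorics.Specification using (k>n⇒nCk≡0)
open import Data.Integer as ℤ using (ℤ; +_; -[1+_]; _⊖_; sign; ∣_∣; _◃_)
import Data.Integer.Properties as ℤ
open import Data.Sign as Sign using (Sign)
open import Relation.Nullary using (¬_; yes; no)
open import Relation.Nullary.Reflects using (ofʸ; ofⁿ)
import Relation.Binary.PropositionalEquality as ≡
open ≡ using (_≡_)

-- The canonical map ℤ → R, so that Algebra.Solver.Ring can normalise with integer
-- coefficients, whose equality is decidable even though R's is not.
module IntegerCoefficients {c ℓ : Level} (R : CommutativeRing c ℓ) where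
  open CommutativeRing R
  open import Algebra.Properties.Semiring.Mult.TCOptimised semiring
    using (_×_; ×-homo-+; ×1-homo-*)
  open import Algebra.Properties.Ring ring using (-‿distribˡ-*; -‿distribʳ-*)
  open import Algebra.Properties.Group +-group
    using (ε⁻¹≈ε; ⁻¹-involutive; //-rightDividesʳ)
  open import Algebra.Properties.AbelianGroup +-abelianGroup using (⁻¹-∙-comm)
  open import Relation.Binary.Reasoning.Setoid setoid

  -- The optimised _×_ has 1 × x = x definitionally, so the constant con (+ 1) is 1# itself.
  ⟦_⟧ : ℤ → Carrier
  ⟦ + n ⟧      = n × 1#
  ⟦ -[1+ n ] ⟧ = - (suc n × 1#)

  signed : Sign → Carrier → Carrier
  signed Sign.+ x = x
  signed Sign.- x = - x

  signed-cong : ∀ s {x y} → x ≈ y → signed s x ≈ signed s y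
  signed-cong Sign.+ x≈y = x≈y
  signed-cong Sign.- x≈y = -‿cong x≈y

  signed-* : ∀ s t x y → signed (s Sign.* t) (x * y) ≈ signed s x * signed t y
  signed-* Sign.+ Sign.+ x y = refl
  signed-* Sign.+ Sign.- x y = -‿distribʳ-* x y
  signed-* Sign.- Sign.+ x y = -‿distribˡ-* x y
  signed-* Sign.- Sign.- x y = begin
    x * y         ≈⟨ ⁻¹-involutive (x * y) ⟨
    - - (x * y)   ≈⟨ -‿cong (-‿distribˡ-* x y) ⟩
    - (- x * y)   ≈⟨ -‿distribʳ-* (- x) y ⟩
    - x * - y     ∎

  ⟦◃⟧ : ∀ s n → ⟦ s ◃ n ⟧ ≈ signed s (n × 1#)
  ⟦◃⟧ Sign.+ zero    = refl
  ⟦◃⟧ Sign.- zero    = sym ε⁻¹≈ε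
  ⟦◃⟧ Sign.+ (suc n) = refl
  ⟦◃⟧ Sign.- (suc n) = refl

  ⟦⟧-signed : ∀ i → ⟦ i ⟧ ≈ signed (sign i) (∣ i ∣ × 1#)
  ⟦⟧-signed (+ n)    = refl
  ⟦⟧-signed -[1+ n ] = refl

  ⟦⊖⟧+ : ∀ m n → ⟦ m ⊖ n ⟧ + n × 1# ≈ m × 1#
  ⟦⊖⟧+ m       zero    = +-identityʳ (m × 1#)
  ⟦⊖⟧+ zero    (suc n) = -‿inverseˡ (suc n × 1#)
  ⟦⊖⟧+ (suc m) (suc n) = begin
    ⟦ suc m ⊖ suc n ⟧ + (1 ℕ.+ n) × 1#     ≡⟨ ≡.cong (λ i → ⟦ i ⟧ + _) (ℤ.[1+m]⊖[1+n]≡m⊖n m n) ⟩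
    ⟦ m ⊖ n ⟧ + (1 ℕ.+ n) × 1#             ≈⟨ +-congˡ (×-homo-+ 1# 1 n) ⟩
    ⟦ m ⊖ n ⟧ + (1# + n × 1#)              ≈⟨ x+[1+y]≈1+[x+y] ⟩
    1# + (⟦ m ⊖ n ⟧ + n × 1#)              ≈⟨ +-congˡ (⟦⊖⟧+ m n) ⟩
    1# + m × 1#                            ≈⟨ ×-homo-+ 1# 1 m ⟨
    (1 ℕ.+ m) × 1#                         ∎
    where
    x+[1+y]≈1+[x+y] : ∀ {x y} → x + (1# + y) ≈ 1# + (x + y)
    x+[1+y]≈1+[x+y] {x} {y} =
      trans (sym (+-assoc x 1# y)) (trans (+-congʳ (+-comm x 1#)) (+-assoc 1# x y))

  ⟦⊖⟧ : ∀ m n → ⟦ m ⊖ n ⟧ ≈ m × 1# - n × 1#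
  ⟦⊖⟧ m n = trans (sym (//-rightDividesʳ (n × 1#) ⟦ m ⊖ n ⟧)) (+-congʳ (⟦⊖⟧+ m n))

  ⟦+⟧ : ∀ i j → ⟦ i ℤ.+ j ⟧ ≈ ⟦ i ⟧ + ⟦ j ⟧
  ⟦+⟧ (+ m)    (+ n)     = ×-homo-+ 1# m n
  ⟦+⟧ (+ m)    -[1+ n ]  = ⟦⊖⟧ m (suc n)
  ⟦+⟧ -[1+ m ] (+ n)     = trans (⟦⊖⟧ n (suc m)) (+-comm _ _)
  ⟦+⟧ -[1+ m ] -[1+ n ]  = begin
    - (suc (suc m ℕ.+ n) × 1#)        ≡⟨ ≡.cong (λ k → - (suc k × 1#)) (ℕ.+-suc m n) ⟨
    - ((suc m ℕ.+ suc n) × 1#)        ≈⟨ -‿cong (×-homo-+ 1# (suc m) (suc n)) ⟩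
    - (suc m × 1# + suc n × 1#)       ≈⟨ ⁻¹-∙-comm _ _ ⟨
    - (suc m × 1#) - suc n × 1#       ∎

  ⟦*⟧ : ∀ i j → ⟦ i ℤ.* j ⟧ ≈ ⟦ i ⟧ * ⟦ j ⟧
  ⟦*⟧ i j = begin
    ⟦ s ◃ (∣ i ∣ ℕ.* ∣ j ∣) ⟧                              ≈⟨ ⟦◃⟧ s (∣ i ∣ ℕ.* ∣ j ∣) ⟩
    signed s ((∣ i ∣ ℕ.* ∣ j ∣) × 1#)                      ≈⟨ signed-cong s (×1-homo-* ∣ i ∣ ∣ j ∣) ⟩
    signed s ((∣ i ∣ × 1#) * (∣ j ∣ × 1#))                 ≈⟨ signed-* (sign i) (sign j) _ _ ⟩
    signed (sign i) (∣ i ∣ × 1#) * signed (sign j) (∣ j ∣ × 1#) ≈⟨ *-cong (⟦⟧-signed i) (⟦⟧-signed j) ⟨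
    ⟦ i ⟧ * ⟦ j ⟧                                          ∎
    where s = sign i Sign.* sign j

  ⟦-⟧ : ∀ i → ⟦ ℤ.- i ⟧ ≈ - ⟦ i ⟧
  ⟦-⟧ (+ zero)   = sym ε⁻¹≈ε
  ⟦-⟧ (+ suc n)  = refl
  ⟦-⟧ -[1+ n ]   = sym (⁻¹-involutive _)

  morphism : ℤ.+-*-rawRing -Raw-AlmostCommutative⟶ fromCommutativeRing R
  morphism = record
    { ⟦_⟧ = ⟦_⟧ ; +-homo = ⟦+⟧ ; *-homo = ⟦*⟧ ; -‿homo = ⟦-⟧ ; 0-homo = refl ; 1-homo = refl }

  _≟-coefficient_ : ∀ i j → Maybe (⟦ i ⟧ ≈ ⟦ j ⟧)
  i ≟-coefficient j with i ℤ.≟ j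
  ... | yes ≡.refl = just refl
  ... | no _       = nothing

  open import Algebra.Solver.Ring ℤ.+-*-rawRing (fromCommutativeRing R) morphism _≟-coefficient_
    public hiding (⟦_⟧)

module FieldProperties {c ℓ : Level} (K : Field c ℓ) where
  open Field K
  open IntegerCoefficients commutativeRing
  open import Relation.Binary.Reasoning.Setoid setoid

  fromℕ-+ : ∀ m n → fromℕ K (m +ℕ n) ≈ fromℕ K m + fromℕ K n
  fromℕ-+ zero    n = sym (+-identityˡ _)
  fromℕ-+ (suc m) n = trans (+-congˡ (fromℕ-+ m n)) (sym (+-assoc _ _ _))

  pow-cong : ∀ {a b} n → a ≈ b → pow K a n ≈ pow K b n
  pow-cong zero    a≈b = refl
  pow-cong (suc n) a≈b = *-cong a≈b (pow-cong n a≈b)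

  pow-+ : ∀ a m n → pow K a (m +ℕ n) ≈ pow K a m * pow K a n
  pow-+ a zero    n = sym (*-identityˡ _)
  pow-+ a (suc m) n = trans (*-congˡ (pow-+ a m n)) (sym (*-assoc _ _ _))

  pow-1# : ∀ n → pow K 1# n ≈ 1#
  pow-1# zero    = refl
  pow-1# (suc n) = trans (*-identityˡ _) (pow-1# n)

  inv-l : ∀ x (x≉0 : ¬ x ≈ 0#) → inv x x≉0 * x ≈ 1#
  inv-l x x≉0 = trans (*-comm _ _) (inv-r x x≉0)

  x*y≈z⇒y≈x⁻¹*z : ∀ {x y z} (x≉0 : ¬ x ≈ 0#) → x * y ≈ z → y ≈ inv x x≉0 * z
  x*y≈z⇒y≈x⁻¹*z {x} {y} {z} x≉0 xy≈z = begin
    y                  ≈⟨ *-identityˡ y ⟨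
    1# * y             ≈⟨ *-congʳ (inv-l x x≉0) ⟨
    (inv x x≉0 * x) * y ≈⟨ *-assoc _ _ _ ⟩
    inv x x≉0 * (x * y) ≈⟨ *-congˡ xy≈z ⟩
    inv x x≉0 * z       ∎

  sumTo-cong : ∀ n {f g : ℕ → Carrier} → (∀ i → i < n → f i ≈ g i) → sumTo K n f ≈ sumTo K n g
  sumTo-cong zero    f≈g = refl
  sumTo-cong (suc n) f≈g =
    +-cong (sumTo-cong n (λ i i<n → f≈g i (ℕ.m<n⇒m<1+n i<n))) (f≈g n ℕ.≤-refl)

  sumTo-+ : ∀ n (f g : ℕ → Carrier) → sumTo K n (λ i → f i + g i) ≈ sumTo K n f + sumTo K n g
  sumTo-+ zero    f g = sym (+-identityˡ _)
  sumTo-+ (suc n) f g = trans (+-congʳ (sumTo-+ n f g))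
    (solve 4 (λ a b c d → (a :+ b) :+ (c :+ d) := (a :+ c) :+ (b :+ d)) refl _ _ _ _)

  sumTo-*ˡ : ∀ n a (f : ℕ → Carrier) → sumTo K n (λ i → a * f i) ≈ a * sumTo K n f
  sumTo-*ˡ zero    a f = sym (zeroʳ _)
  sumTo-*ˡ (suc n) a f = trans (+-congʳ (sumTo-*ˡ n a f)) (sym (distribˡ _ _ _))

  sumTo-peel : ∀ n (f : ℕ → Carrier) → sumTo K (suc n) f ≈ f 0 + sumTo K n (f ∘ suc)
  sumTo-peel zero    f = trans (+-identityˡ _) (sym (+-identityʳ _))
  sumTo-peel (suc n) f = trans (+-congʳ (sumTo-peel n f)) (+-assoc _ _ _)

  -- Defined exactly like δ₁, so that δ₁ is definitionally δ 1.
  δ : ℕ → ℕ → Carrier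
  δ k j = if j ≡ᵇ k then 1# else 0#

  -- umbral x c n expands (X + c)^n and then replaces X^i by x i, using the Pascal
  -- recursion (X + c)^(n+1) = c (X + c)^n + X (X + c)^n.
  umbral : (ℕ → Carrier) → Carrier → ℕ → Carrier
  umbral x c zero    = x 0
  umbral x c (suc n) = c * umbral x c n + umbral (x ∘ suc) c n

  binomialSum : (ℕ → Carrier) → Carrier → ℕ → Carrier
  binomialSum x c n = sumTo K (suc n) (λ i → fromℕ K (n C i) * x i * pow K c (n ∸ i))

  n∸i≡1+n∸[1+i] : ∀ {i n} → i < n → n ∸ i ≡ suc (n ∸ suc i)
  n∸i≡1+n∸[1+i] {n = suc n} (s≤s i≤n) = ℕ.+-∸-assoc 1 i≤n

  binomialSum-suc : ∀ n x c →
    binomialSum x c (suc n) ≈ c * binomialSum x c n + binomialSum (x ∘ suc) c n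
  binomialSum-suc n x c = begin
    sumTo K (suc (suc n)) h                                  ≈⟨ sumTo-peel (suc n) h ⟩
    h 0 + sumTo K (suc n) (h ∘ suc)
      ≈⟨ +-congˡ (trans (sumTo-cong (suc n) (λ i _ → pascal i)) (sumTo-+ (suc n) b a)) ⟩
    h 0 + (sumTo K (suc n) b + binomialSum (x ∘ suc) c n)    ≈⟨ +-assoc _ _ _ ⟨
    (h 0 + sumTo K (suc n) b) + binomialSum (x ∘ suc) c n    ≈⟨ +-congʳ head ⟩
    c * binomialSum x c n + binomialSum (x ∘ suc) c n        ∎
    where
    g h a b : ℕ → Carrier
    g i = fromℕ K (n C i) * x i * pow K c (n ∸ i)
    h i = fromℕ K (suc n C i) * x i * pow K c (suc n ∸ i)
    a i = fromℕ K (n C i) * x (suc i) * pow K c (n ∸ i)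
    b i = fromℕ K (n C suc i) * x (suc i) * pow K c (n ∸ i)

    pascal : ∀ i → h (suc i) ≈ b i + a i
    pascal i = begin
      fromℕ K (suc n C suc i) * x (suc i) * pow K c (n ∸ i)
        ≡⟨ ≡.cong (λ k → fromℕ K k * x (suc i) * pow K c (n ∸ i)) (nCk+nC[k+1]≡[n+1]C[k+1] n i) ⟨
      fromℕ K (n C i +ℕ n C suc i) * x (suc i) * pow K c (n ∸ i)
        ≈⟨ *-congʳ (*-congʳ (fromℕ-+ (n C i) (n C suc i))) ⟩
      (fromℕ K (n C i) + fromℕ K (n C suc i)) * x (suc i) * pow K c (n ∸ i)
        ≈⟨ solve 4 (λ u v y z → (u :+ v) :* y :* z := v :* y :* z :+ u :* y :* z) refl _ _ _ _ ⟩
      b i + a i ∎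

    b≈c*g : ∀ i → i < n → b i ≈ c * g (suc i)
    b≈c*g i i<n = begin
      fromℕ K (n C suc i) * x (suc i) * pow K c (n ∸ i)
        ≡⟨ ≡.cong (λ k → fromℕ K (n C suc i) * x (suc i) * pow K c k) (n∸i≡1+n∸[1+i] i<n) ⟩
      fromℕ K (n C suc i) * x (suc i) * (c * pow K c (n ∸ suc i))
        ≈⟨ solve 4 (λ u y c z → u :* y :* (c :* z) := c :* (u :* y :* z)) refl _ _ _ _ ⟩
      c * g (suc i) ∎

    b-top≈0 : b n ≈ 0#
    b-top≈0 = begin
      fromℕ K (n C suc n) * x (suc n) * pow K c (n ∸ n)
        ≡⟨ ≡.cong (λ k → fromℕ K k * x (suc n) * pow K c (n ∸ n)) (k>n⇒nCk≡0 (ℕ.n<1+n n)) ⟩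
      0# * x (suc n) * pow K c (n ∸ n)                  ≈⟨ trans (*-congʳ (zeroˡ _)) (zeroˡ _) ⟩
      0# ∎

    head : h 0 + sumTo K (suc n) b ≈ c * binomialSum x c n
    head = begin
      h 0 + (sumTo K n b + b n)                          ≈⟨ +-cong h0≈c*g0 (+-cong (sumTo-cong n b≈c*g) b-top≈0) ⟩
      c * g 0 + (sumTo K n (λ i → c * g (suc i)) + 0#)   ≈⟨ +-congˡ (+-identityʳ _) ⟩
      c * g 0 + sumTo K n (λ i → c * g (suc i))          ≈⟨ sumTo-peel n (λ i → c * g i) ⟨
      sumTo K (suc n) (λ i → c * g i)                    ≈⟨ sumTo-*ˡ (suc n) c g ⟩
      c * binomialSum x c n                              ∎
      where
      h0≈c*g0 : h 0 ≈ c * g 0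
      h0≈c*g0 = solve 3 (λ u c z → u :* (c :* z) := c :* (u :* z)) refl (fromℕ K 1 * x 0) c (pow K c n)

  umbral≈binomialSum : ∀ n x c → umbral x c n ≈ binomialSum x c n
  umbral≈binomialSum zero    x c =
    solve 1 (λ y → y := con (+ 0) :+ (con (+ 1) :+ con (+ 0)) :* y :* con (+ 1)) refl (x 0)
  umbral≈binomialSum (suc n) x c = sym (trans (binomialSum-suc n x c)
    (+-cong (*-congˡ (sym (umbral≈binomialSum n x c))) (sym (umbral≈binomialSum n (x ∘ suc) c))))

  umbral-cong : ∀ n {x y : ℕ → Carrier} {c d} → c ≈ d → (∀ i → x i ≈ y i) → umbral x c n ≈ umbral y d n
  umbral-cong zero    c≈d x≈y = x≈y 0
  umbral-cong (suc n) c≈d x≈y =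
    +-cong (*-cong c≈d (umbral-cong n c≈d x≈y)) (umbral-cong n c≈d (x≈y ∘ suc))

  umbral-zero : ∀ n c → umbral (λ _ → 0#) c n ≈ 0#
  umbral-zero zero    c = refl
  umbral-zero (suc n) c =
    trans (+-cong (trans (*-congˡ (umbral-zero n c)) (zeroʳ c)) (umbral-zero n c)) (+-identityʳ 0#)

  umbral-distrib-+ : ∀ n (x y : ℕ → Carrier) c →
    umbral (λ i → x i + y i) c n ≈ umbral x c n + umbral y c n
  umbral-distrib-+ zero    x y c = refl
  umbral-distrib-+ (suc n) x y c =
    trans (+-cong (*-congˡ (umbral-distrib-+ n x y c)) (umbral-distrib-+ n (x ∘ suc) (y ∘ suc) c))
      (solve 5 (λ c a b d e → c :* (a :+ b) :+ (d :+ e) := (c :* a :+ d) :+ (c :* b :+ e)) refl _ _ _ _ _)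

  umbral-*ˡ : ∀ n a (x : ℕ → Carrier) c → umbral (λ i → a * x i) c n ≈ a * umbral x c n
  umbral-*ˡ zero    a x c = refl
  umbral-*ˡ (suc n) a x c =
    trans (+-cong (*-congˡ (umbral-*ˡ n a x c)) (umbral-*ˡ n a (x ∘ suc) c))
      (solve 4 (λ c a b d → c :* (a :* b) :+ a :* d := a :* (c :* b :+ d)) refl _ _ _ _)

  umbral-assoc : ∀ n (x : ℕ → Carrier) c d → umbral x (c + d) n ≈ umbral (λ j → umbral x c j) d n
  umbral-assoc zero    x c d = refl
  umbral-assoc (suc n) x c d = begin
    (c + d) * umbral x (c + d) n + umbral (x ∘ suc) (c + d) n
      ≈⟨ +-cong (*-congˡ (umbral-assoc n x c d)) (umbral-assoc n (x ∘ suc) c d) ⟩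
    (c + d) * A + B
      ≈⟨ solve 4 (λ c d a b → (c :+ d) :* a :+ b := d :* a :+ (c :* a :+ b)) refl c d A B ⟩
    d * A + (c * A + B)
      ≈⟨ +-congˡ (trans (umbral-distrib-+ n _ _ d) (+-congʳ (umbral-*ˡ n c _ d))) ⟨
    d * A + umbral (λ j → c * umbral x c j + umbral (x ∘ suc) c j) d n ∎
    where
    A = umbral (λ j → umbral x c j) d n
    B = umbral (λ j → umbral (x ∘ suc) c j) d n

  umbral-homogeneous : ∀ n a (x : ℕ → Carrier) c →
    umbral (λ i → pow K a i * x i) (a * c) n ≈ pow K a n * umbral x c n
  umbral-homogeneous zero    a x c = refl
  umbral-homogeneous (suc n) a x c = begin
    a * c * umbral (λ i → pow K a i * x i) (a * c) n + umbral (λ i → a * pow K a i * x (suc i)) (a * c) n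
      ≈⟨ +-cong (*-congˡ (umbral-homogeneous n a x c))
           (trans (umbral-cong n refl (λ i → *-assoc _ _ _))
             (trans (umbral-*ˡ n a _ _) (*-congˡ (umbral-homogeneous n a (x ∘ suc) c)))) ⟩
    a * c * (pow K a n * umbral x c n) + a * (pow K a n * umbral (x ∘ suc) c n)
      ≈⟨ solve 5 (λ a c p g h → a :* c :* (p :* g) :+ a :* (p :* h) := a :* p :* (c :* g :+ h)) refl _ _ _ _ _ ⟩
    a * pow K a n * (c * umbral x c n + umbral (x ∘ suc) c n) ∎

  umbral-0# : ∀ n x → umbral x 0# n ≈ x n
  umbral-0# zero    x = refl
  umbral-0# (suc n) x =
    trans (+-cong (zeroˡ _) (umbral-0# n (x ∘ suc))) (+-identityˡ _)

  umbral-δ : ∀ n k → umbral (δ k) 1# n ≈ fromℕ K (n C k)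
  umbral-δ zero    zero    = sym (+-identityʳ 1#)
  umbral-δ zero    (suc k) = refl
  umbral-δ (suc n) zero    = begin
    1# * umbral (δ 0) 1# n + umbral (λ _ → 0#) 1# n ≈⟨ +-cong (*-identityˡ _) (umbral-zero n 1#) ⟩
    umbral (δ 0) 1# n + 0#                          ≈⟨ +-identityʳ _ ⟩
    umbral (δ 0) 1# n                               ≈⟨ umbral-δ n 0 ⟩
    fromℕ K 1                                       ∎
  umbral-δ (suc n) (suc k) = begin
    1# * umbral (δ (suc k)) 1# n + umbral (δ k) 1# n
      ≈⟨ +-cong (trans (*-identityˡ _) (umbral-δ n (suc k))) (umbral-δ n k) ⟩
    fromℕ K (n C suc k) + fromℕ K (n C k)   ≈⟨ +-comm _ _ ⟩
    fromℕ K (n C k) + fromℕ K (n C suc k)   ≈⟨ fromℕ-+ (n C k) (n C suc k) ⟨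
    fromℕ K (n C k +ℕ n C suc k)            ≡⟨ ≡.cong (fromℕ K) (nCk+nC[k+1]≡[n+1]C[k+1] n k) ⟩
    fromℕ K (suc n C suc k)                 ∎

module CarlitzProperties {c ℓ : Level} (K : Field c ℓ) (q : Field.Carrier K)
  (q≉0 : ¬ (Field._≈_ K q (Field.0# K)))
  (notRoot : (m : ℕ) → ¬ (Field._≈_ K (pow K q (suc m)) (Field.1# K))) where
  open Field K
  open Carlitz K q q≉0 notRoot
  open FieldProperties K
  open IntegerCoefficients commutativeRing
  open import Relation.Binary.Reasoning.Setoid setoid

  β-suc : ∀ m → β (suc m) ≡ next (suc m) (βupto m)
  β-suc m with suc m ≤ᵇ m | ℕ.≤ᵇ-reflects-≤ (suc m) m
  ... | false | _          = ≡.refl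
  ... | true  | ofʸ 1+m≤m  = ⊥-elim (ℕ.1+n≰n 1+m≤m)

  βupto≡β : ∀ {m i} → i ≤ m → βupto m i ≡ β i
  βupto≡β {zero}      z≤n = ≡.refl
  βupto≡β {suc m} {i} i≤1+m with i ≤ᵇ m | ℕ.≤ᵇ-reflects-≤ i m
  ... | true  | ofʸ i≤m = βupto≡β i≤m
  ... | false | ofⁿ i≰m with ℕ.≤-antisym i≤1+m (ℕ.≰⇒> i≰m)
  ...   | ≡.refl = ≡.sym (β-suc m)

  β-recurrence : ∀ k → 0 < k →
    (pow K q (suc k) - 1#) * β k ≈ δ₁ k - q * sumTo K k (λ i → fromℕ K (k C i) * pow K q i * β i)
  β-recurrence (suc m) _ = begin
    D * β (suc m)            ≡⟨ ≡.cong (D *_) (β-suc m) ⟩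
    D * (inv D D≉0 * E)      ≈⟨ *-assoc _ _ _ ⟨
    (D * inv D D≉0) * E      ≈⟨ *-congʳ (inv-r D D≉0) ⟩
    1# * E                   ≈⟨ *-identityˡ E ⟩
    E                        ≈⟨ +-congˡ (-‿cong (*-congˡ (sumTo-cong (suc m) (λ i i<k →
                                  *-congˡ (reflexive (βupto≡β (ℕ.≤-pred i<k))))))) ⟩
    δ₁ (suc m) - q * sumTo K (suc m) (λ i → fromℕ K (suc m C i) * pow K q i * β i) ∎
    where
    D = pow K q (suc (suc m)) - 1#
    D≉0 = denom≉0 (suc m)
    E = δ₁ (suc m) - q * sumTo K (suc m) (λ i → fromℕ K (suc m C i) * pow K q i * βupto m i)

  [0]q≈0 : [ 0 ]q ≈ 0#
  [0]q≈0 = trans (*-congʳ (-‿inverseʳ 1#)) (zeroˡ _)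

  [1+x]q≈q[x]q+1 : ∀ x → [ suc x ]q ≈ q * [ x ]q + 1#
  [1+x]q≈q[x]q+1 x = begin
    (1# - q * Q) * i                     ≈⟨ solve 3 (λ q Q i → (con (+ 1) :- q :* Q) :* i
                                                 := q :* ((con (+ 1) :- Q) :* i) :+ (con (+ 1) :- q) :* i) refl q Q i ⟩
    q * ((1# - Q) * i) + (1# - q) * i    ≈⟨ +-congˡ (inv-r (1# - q) 1-q≉0) ⟩
    q * [ x ]q + 1#                      ∎
    where
    Q = pow K q x
    i = inv (1# - q) 1-q≉0

  βpoly≈umbral : ∀ n x → βpoly n x ≈ umbral (λ i → β i * pow K q (i ℕ.* x)) [ x ]q n
  βpoly≈umbral n x = sym (trans (umbral≈binomialSum n _ _)
    (sumTo-cong (suc n) (λ i _ → *-congʳ (sym (*-assoc _ _ _)))))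

  βpoly₀≈1 : ∀ x → βpoly 0 x ≈ 1#
  βpoly₀≈1 x = solve 0 (con (+ 0) :+ (con (+ 1) :+ con (+ 0)) :* con (+ 1) :* con (+ 1) :* con (+ 1)
                         := con (+ 1)) refl

  βpoly-at-0 : ∀ n → βpoly n 0 ≈ β n
  βpoly-at-0 n = begin
    βpoly n 0                                            ≈⟨ βpoly≈umbral n 0 ⟩
    umbral (λ i → β i * pow K q (i ℕ.* 0)) [ 0 ]q n      ≈⟨ umbral-cong n [0]q≈0 q⁰≈1 ⟩
    umbral β 0# n                                        ≈⟨ umbral-0# n β ⟩
    β n                                                  ∎
    where
    q⁰≈1 : ∀ i → β i * pow K q (i ℕ.* 0) ≈ β i
    q⁰≈1 i = trans (reflexive (≡.cong (λ k → β i * pow K q k) (ℕ.*-zeroʳ i))) (*-identityʳ (β i))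

  βpoly-translation : ∀ n x → βpoly n (suc x) ≈ umbral (λ j → pow K q j * βpoly j x) 1# n
  βpoly-translation n x = begin
    βpoly n (suc x)                                          ≈⟨ βpoly≈umbral n (suc x) ⟩
    umbral (λ i → β i * pow K q (i ℕ.* suc x)) [ suc x ]q n   ≈⟨ umbral-cong n ([1+x]q≈q[x]q+1 x) split ⟩
    umbral (λ i → pow K q i * a i) (q * [ x ]q + 1#) n       ≈⟨ umbral-assoc n _ _ 1# ⟩
    umbral (λ j → umbral (λ i → pow K q i * a i) (q * [ x ]q) j) 1# n
      ≈⟨ umbral-cong n refl (λ j → trans (umbral-homogeneous j q a [ x ]q) (*-congˡ (sym (βpoly≈umbral j x)))) ⟩
    umbral (λ j → pow K q j * βpoly j x) 1# n                ∎
    where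
    a : ℕ → Carrier
    a i = β i * pow K q (i ℕ.* x)
    split : ∀ i → β i * pow K q (i ℕ.* suc x) ≈ pow K q i * a i
    split i = begin
      β i * pow K q (i ℕ.* suc x)              ≡⟨ ≡.cong (λ k → β i * pow K q k) (ℕ.*-suc i x) ⟩
      β i * pow K q (i +ℕ i ℕ.* x)             ≈⟨ *-congˡ (pow-+ q i (i ℕ.* x)) ⟩
      β i * (pow K q i * pow K q (i ℕ.* x))    ≈⟨ solve 3 (λ b p r → b :* (p :* r) := p :* (b :* r)) refl _ _ _ ⟩
      pow K q i * a i                          ∎

  βpoly-at-1 : ∀ k → βpoly k 1 ≈ sumTo K k (λ i → fromℕ K (k C i) * pow K q i * β i) + pow K q k * β k
  βpoly-at-1 k = +-cong (sumTo-cong k (λ i _ → term i)) (trans (term k) top)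
    where
    [1]q≈1 : [ 1 ]q ≈ 1#
    [1]q≈1 = trans ([1+x]q≈q[x]q+1 0) (trans (+-congʳ (trans (*-congˡ [0]q≈0) (zeroʳ q))) (+-identityˡ 1#))
    term : ∀ i → fromℕ K (k C i) * β i * pow K q (i ℕ.* 1) * pow K [ 1 ]q (k ∸ i)
               ≈ fromℕ K (k C i) * pow K q i * β i
    term i = begin
      fromℕ K (k C i) * β i * pow K q (i ℕ.* 1) * pow K [ 1 ]q (k ∸ i)
        ≈⟨ *-cong (reflexive (≡.cong (λ e → fromℕ K (k C i) * β i * pow K q e) (ℕ.*-identityʳ i)))
                  (trans (pow-cong (k ∸ i) [1]q≈1) (pow-1# (k ∸ i))) ⟩
      fromℕ K (k C i) * β i * pow K q i * 1#
        ≈⟨ solve 3 (λ u b p → u :* b :* p :* con (+ 1) := u :* p :* b) refl _ _ _ ⟩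
      fromℕ K (k C i) * pow K q i * β i ∎
    top : fromℕ K (k C k) * pow K q k * β k ≈ pow K q k * β k
    top = begin
      fromℕ K (k C k) * pow K q k * β k   ≡⟨ ≡.cong (λ e → fromℕ K e * pow K q k * β k) (nCn≡1 k) ⟩
      (1# + 0#) * pow K q k * β k         ≈⟨ solve 2 (λ p b → (con (+ 1) :+ con (+ 0)) :* p :* b := p :* b) refl _ _ ⟩
      pow K q k * β k                     ∎

  carlitz-relation : ∀ k → 0 < k → q * βpoly k 1 ≈ β k + δ₁ k
  carlitz-relation k 0<k = begin
    q * βpoly k 1                          ≈⟨ *-congˡ (βpoly-at-1 k) ⟩
    q * (T + Q * β k)                      ≈⟨ solve 4 (λ q t Q b → q :* (t :+ Q :* b)
                                                := (q :* t :+ (q :* Q :- con (+ 1)) :* b) :+ b) refl q T Q (β k) ⟩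
    (q * T + (q * Q - 1#) * β k) + β k     ≈⟨ +-congʳ (+-congˡ (β-recurrence k 0<k)) ⟩
    (q * T + (δ₁ k - q * T)) + β k         ≈⟨ solve 3 (λ t d b → (t :+ (d :- t)) :+ b := b :+ d)
                                                refl (q * T) (δ₁ k) (β k) ⟩
    β k + δ₁ k                             ∎
    where
    T = sumTo K k (λ i → fromℕ K (k C i) * pow K q i * β i)
    Q = pow K q k

  βpoly-at-1≈q⁻¹β : ∀ {n} → 1 < n → βpoly n 1 ≈ q⁻¹ * β n
  βpoly-at-1≈q⁻¹β {suc (suc n)} (s≤s (s≤s z≤n)) =
    x*y≈z⇒y≈x⁻¹*z q≉0 (trans (carlitz-relation (suc (suc n)) (s≤s z≤n)) (+-identityʳ _))

  pow*δ₁ : ∀ k → pow K q k * δ₁ (suc k) ≈ δ₁ (suc k)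
  pow*δ₁ zero    = *-identityˡ 1#
  pow*δ₁ (suc k) = zeroʳ _

  -- Uniformly in j: q^j β_j(1) is q^(j-1) (β_j + δ_{j,1}) for j ≥ 1, and 1 for j = 0.
  pow*βpoly-at-1 : ∀ j →
    pow K q j * βpoly j 1 ≈ q⁻¹ * (pow K q j * βpoly j 0) + (δ₁ j + (1# - q⁻¹) * δ 0 j)
  pow*βpoly-at-1 zero = begin
    1# * βpoly 0 1
      ≈⟨ *-congˡ (βpoly₀≈1 1) ⟩
    1# * 1#
      ≈⟨ solve 1 (λ i → con (+ 1) :* con (+ 1)
                     := i :* (con (+ 1) :* con (+ 1)) :+ (con (+ 0) :+ (con (+ 1) :- i) :* con (+ 1)))
                 refl q⁻¹ ⟩
    q⁻¹ * (1# * 1#) + (0# + (1# - q⁻¹) * 1#)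
      ≈⟨ +-congʳ (*-congˡ (*-congˡ (βpoly₀≈1 0))) ⟨
    q⁻¹ * (1# * βpoly 0 0) + (0# + (1# - q⁻¹) * 1#) ∎
  pow*βpoly-at-1 (suc k) = begin
    q * Q * βpoly (suc k) 1
      ≈⟨ solve 3 (λ q Q p → q :* Q :* p := Q :* (q :* p)) refl q Q _ ⟩
    Q * (q * βpoly (suc k) 1)
      ≈⟨ *-congˡ (carlitz-relation (suc k) (s≤s z≤n)) ⟩
    Q * (b + d)
      ≈⟨ trans (distribˡ Q b d) (+-congˡ (pow*δ₁ k)) ⟩
    Q * b + d
      ≈⟨ +-congʳ (trans (*-congʳ (inv-l q q≉0)) (*-identityˡ _)) ⟨
    (q⁻¹ * q) * (Q * b) + d
      ≈⟨ solve 5 (λ i q Q b d → i :* q :* (Q :* b) :+ d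
                     := i :* (q :* Q :* b) :+ (d :+ (con (+ 1) :- i) :* con (+ 0)))
                 refl q⁻¹ q Q b d ⟩
    q⁻¹ * (q * Q * b) + (d + (1# - q⁻¹) * 0#)
      ≈⟨ +-congʳ (*-congˡ (*-congˡ (βpoly-at-0 (suc k)))) ⟨
    q⁻¹ * (q * Q * βpoly (suc k) 0) + (d + (1# - q⁻¹) * 0#) ∎
    where
    Q = pow K q k
    b = β (suc k)
    d = δ₁ (suc k)

proposition2 : {c ℓ : Level} (K : Field c ℓ) (q : Field.Carrier K)
    (q≉0 : ¬ (Field._≈_ K q (Field.0# K)))
    (notRoot : (m : ℕ) → ¬ (Field._≈_ K (pow K q (suc m)) (Field.1# K)))
    (n : ℕ) → 1 < n →
    let open Field K
        open Carlitz K q q≉0 notRoot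
    in βpoly n 2 ≈ (q⁻¹ * q⁻¹) * β n + fromℕ K (n +ℕ 1) - q⁻¹
proposition2 K q q≉0 notRoot n 1<n = begin
  βpoly n 2                                            ≈⟨ βpoly-translation n 1 ⟩
  umbral (λ j → pow K q j * βpoly j 1) 1# n            ≈⟨ umbral-cong n refl pow*βpoly-at-1 ⟩
  umbral (λ j → q⁻¹ * (pow K q j * βpoly j 0) + (δ₁ j + (1# - q⁻¹) * δ 0 j)) 1# n
    ≈⟨ trans (umbral-distrib-+ n _ _ 1#) (+-cong (umbral-*ˡ n q⁻¹ _ 1#)
         (trans (umbral-distrib-+ n _ _ 1#) (+-congˡ (umbral-*ˡ n _ (δ 0) 1#)))) ⟩
  q⁻¹ * umbral (λ j → pow K q j * βpoly j 0) 1# n + (umbral (δ 1) 1# n + (1# - q⁻¹) * umbral (δ 0) 1# n)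
    ≈⟨ +-cong (*-congˡ (sym (βpoly-translation n 0))) (+-cong (umbral-δ n 1) (*-congˡ (umbral-δ n 0))) ⟩
  q⁻¹ * βpoly n 1 + (fromℕ K (n C 1) + (1# - q⁻¹) * fromℕ K 1)
    ≈⟨ +-cong (*-congˡ (βpoly-at-1≈q⁻¹β 1<n)) (+-congʳ (reflexive (≡.cong (fromℕ K) (nC1≡n n)))) ⟩
  q⁻¹ * (q⁻¹ * β n) + (fromℕ K n + (1# - q⁻¹) * fromℕ K 1)
    ≈⟨ solve 3 (λ i b N → i :* (i :* b) :+ (N :+ (con (+ 1) :- i) :* (con (+ 1) :+ con (+ 0)))
                      := i :* i :* b :+ (N :+ (con (+ 1) :+ con (+ 0))) :- i)
         refl q⁻¹ (β n) (fromℕ K n) ⟩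
  (q⁻¹ * q⁻¹) * β n + (fromℕ K n + fromℕ K 1) - q⁻¹    ≈⟨ +-congʳ (+-congˡ (fromℕ-+ n 1)) ⟨
  (q⁻¹ * q⁻¹) * β n + fromℕ K (n +ℕ 1) - q⁻¹           ∎
  where
  open Field K
  open Carlitz K q q≉0 notRoot
  open FieldProperties K
  open CarlitzProperties K q q≉0 notRoot
  open IntegerCoefficients commutativeRing
  open import Relation.Binary.Reasoning.Setoid setoid
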